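{- Let $a \ge 2$ and $n \ge 1$ be integers. For every vertex $v \in [n]$, the inequality $$\sum_{e\in \delta(v)} 2x_e + \sum_{e\in E(K_n)\setminus \delta(v)} x_e \le ex(n+1,a,2)$$ is valid for $T(n,a,2)$. Furthermore, the inequality $\sum_{e \in E(K_n)} x_e \le \left\lfloor \frac{n}{n+2}\, ex(n+1,a,2)\right\rfloor$ is valid for $T(n,a,2)$.
   Context: $K_n$ is the complete graph on vertex set $[n]=\{1,\dots,n\}$; $\delta(v)$ is the set of edges of $K_n$ incident to $v$. $T(n,a,2)\subseteq\mathbb{R}^{E(K_n)}$ is the convex hull of the characteristic vectors of all edge sets $F\subseteq E(K_n)$ containing no clique on $a$ vertices. $ex(m,a,2)$ is the maximum number of edges of a graph on $m$ vertices with no clique on $a$ vertices. An inequality is valid for a polytope if every point of the polytope satisfies it.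
   Formalization: Only the points of T(n,a,2) with rational coordinates, written as convex combinations with rational coefficients, are considered, rather than all points of T(n,a,2) ⊆ ℝ^E(K_n). -}

module Defs where

open import Data.Bool using (Bool; true; false; if_then_else_; _∨_)
open import Data.Nat as ℕ using (ℕ; suc)
open import Data.Fin using (Fin; _<_; _<?_)
open import Data.Fin.Properties using (_≟_)
open import Data.List using (List; []; _∷_; foldr; map; allFin)
open import Data.Product using (Σ; ∃; _×_; _,_)
open import Data.Sum using (_⊎_)
import Data.Integer as ℤ
open import Data.Rational as ℚ using (ℚ; 0ℚ; 1ℚ)
open import Data.List.Relation.Unary.All using (All)
open import Relation.Nullary using (¬_; does)
open import Relation.Binary.PropositionalEquality using (_≡_)

-- Vertices of K_n are Fin n.  An edge {i,j} of K_n is represented by the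
-- ordered pair (i , j) with i < j.  An edge set F ⊆ E(K_n) (equivalently a
-- graph on vertex set Fin n) is a function Fin n → Fin n → Bool, of which
-- only the entries with i < j are meaningful.  Likewise a vector
-- x ∈ ℝ^{E(K_n)} is a function Fin n → Fin n → ℚ (entries with i < j).
EdgeSet : ℕ → Set
EdgeSet n = Fin n → Fin n → Bool

EdgeVec : ℕ → Set
EdgeVec n = Fin n → Fin n → ℚ

Adj : ∀ {n} → EdgeSet n → Fin n → Fin n → Set
Adj F u v = (u < v × F u v ≡ true) ⊎ (v < u × F v u ≡ true)

HasClique : ∀ {n} → ℕ → EdgeSet n → Set
HasClique {n} a F =
  Σ (Fin a → Fin n) λ f → ∀ p q → ¬ (p ≡ q) → Adj F (f p) (f q)

CliqueFree : ∀ {n} → ℕ → EdgeSet n → Set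
CliqueFree a F = ¬ HasClique a F

sumEℕ : ∀ {n} → (Fin n → Fin n → ℕ) → ℕ
sumEℕ {n} g = foldr ℕ._+_ 0 (map (λ i → foldr ℕ._+_ 0
  (map (λ j → if does (i <? j) then g i j else 0) (allFin n))) (allFin n))

sumEℚ : ∀ {n} → (Fin n → Fin n → ℚ) → ℚ
sumEℚ {n} g = foldr ℚ._+_ 0ℚ (map (λ i → foldr ℚ._+_ 0ℚ
  (map (λ j → if does (i <? j) then g i j else 0ℚ) (allFin n))) (allFin n))

numEdges : ∀ {n} → EdgeSet n → ℕ
numEdges F = sumEℕ (λ i j → if F i j then 1 else 0)

-- ex(m,a,2) = k : k is the maximum number of edges of an a-clique-free
-- graph on m vertices
IsEx : ℕ → ℕ → ℕ → Set
IsEx m a k = (∃ λ (F : EdgeSet m) → CliqueFree a F × numEdges F ≡ k)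
           × (∀ (F : EdgeSet m) → CliqueFree a F → numEdges F ℕ.≤ k)

χ : ∀ {n} → EdgeSet n → EdgeVec n
χ F i j = if F i j then 1ℚ else 0ℚ

InT : (n a : ℕ) → EdgeVec n → Set
InT n a x = Σ (List (ℚ × EdgeSet n)) λ L →
    All (λ { (λ′ , F) → (0ℚ ℚ.≤ λ′) × CliqueFree a F }) L
  × (foldr ℚ._+_ 0ℚ (map (λ { (λ′ , F) → λ′ }) L) ≡ 1ℚ)
  × (∀ (i j : Fin n) → i < j →
       x i j ≡ foldr ℚ._+_ 0ℚ (map (λ { (λ′ , F) → λ′ ℚ.* χ F i j }) L))

starCoeff : ∀ {n} → Fin n → Fin n → Fin n → ℚ
starCoeff v i j =
  if does (i ≟ v) ∨ does (j ≟ v) then ℚ.1ℚ ℚ.+ ℚ.1ℚ else 1ℚ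

ℕtoℚ : ℕ → ℚ
ℕtoℚ k = ℤ.+ k ℚ./ 1

module Submission where

-- Let F be an a-clique-free graph on [n] and v a vertex.  Adding a twin v′ of v
-- (adjacent to exactly the neighbours of v, not to v) creates no a-clique, since a
-- clique contains at most one of v, v′.  The new graph has |F| + deg v edges, which
-- is the left-hand side of the first inequality at χ(F); hence it is at most
-- ex(n+1,a,2).  Summing over v, and using Σ_v deg v = 2|F|, gives
-- (n+2)|F| ≤ n·ex(n+1,a,2).  Both inequalities are linear, so holding at the
-- vertices χ(F) of T(n,a,2) they hold on all of T(n,a,2).

open import Defs
open import Data.Nat using (ℕ; suc; _≥_; _+_; _*_; _/_)
open import Data.Fin using (Fin)
open import Data.Product using (_×_)
open import Data.Rational as ℚ using (ℚ)

open import Algebra.Bundles using (CommutativeMonoid)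
open import Data.Bool using (Bool; true; false; if_then_else_; _∨_)
import Data.Nat as ℕ
import Data.Nat.Properties as ℕ
open import Data.Nat.Coprimality using (1-coprimeTo) renaming (sym to coprime-sym)
open import Data.Nat.DivMod using (m*n/n≡m; /-monoˡ-≤)
open import Data.Fin using (zero; suc; _<_; _<?_)
open import Data.Fin.Properties using (_≟_; <-irrefl; <-asym)
open import Data.List using (List; []; _∷_; foldr; map; allFin)
open import Data.List.Properties using (map-tabulate)
open import Data.List.Relation.Unary.All using (All; []; _∷_)
open import Data.Product using (_,_; proj₁; proj₂)
open import Data.Sum using (inj₁; inj₂)
open import Data.Empty using (⊥-elim)
import Data.Integer as ℤ
import Data.Integer.Properties as ℤ
import Data.Rational.Properties as ℚ
open import Function using (id; _∘_)
open import Relation.Nullary using (Dec; yes; no; does)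
open import Relation.Binary.PropositionalEquality

module FinSum {c ℓ} (M : CommutativeMonoid c ℓ) where

  open CommutativeMonoid M
    using (_≈_; _∙_; ε; ∙-cong; ∙-congˡ; identityˡ; identityʳ; commutativeSemigroup)
    renaming (Carrier to A; refl to ≈-refl; sym to ≈-sym; trans to ≈-trans; reflexive to ≈-reflexive)
  open import Algebra.Properties.CommutativeSemigroup commutativeSemigroup using (interchange)

  ∑ : {B : Set} → List B → (B → A) → A
  ∑ xs f = foldr _∙_ ε (map f xs)

  when : Bool → A → A
  when b x = if b then x else ε

  sumE : ∀ {n} → (Fin n → Fin n → A) → A
  sumE {n} g = ∑ (allFin n) (λ i → ∑ (allFin n) (λ j → when (does (i <? j)) (g i j)))

  ∑-cong : ∀ {B : Set} (xs : List B) {f g : B → A} → (∀ b → f b ≈ g b) → ∑ xs f ≈ ∑ xs g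
  ∑-cong []       f≈g = ≈-refl
  ∑-cong (x ∷ xs) f≈g = ∙-cong (f≈g x) (∑-cong xs f≈g)

  ∑-ε : ∀ {B : Set} (xs : List B) → ∑ xs (λ _ → ε) ≈ ε
  ∑-ε []       = ≈-refl
  ∑-ε (x ∷ xs) = ≈-trans (identityˡ _) (∑-ε xs)

  ∑-distrib : ∀ {B : Set} (xs : List B) (f g : B → A) → ∑ xs (λ b → f b ∙ g b) ≈ ∑ xs f ∙ ∑ xs g
  ∑-distrib []       f g = ≈-sym (identityˡ ε)
  ∑-distrib (x ∷ xs) f g = ≈-trans (∙-congˡ (∑-distrib xs f g)) (interchange (f x) (g x) _ _)

  ∑-swap : ∀ {B C : Set} (xs : List B) (ys : List C) (f : B → C → A) →
           ∑ xs (λ b → ∑ ys (f b)) ≈ ∑ ys (λ c → ∑ xs (λ b → f b c))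
  ∑-swap []       ys f = ≈-sym (∑-ε ys)
  ∑-swap (x ∷ xs) ys f = ≈-trans (∙-congˡ (∑-swap xs ys f)) (≈-sym (∑-distrib ys (f x) _))

  ∑-allFin-suc : ∀ n (f : Fin (suc n) → A) → ∑ (allFin (suc n)) f ≈ f zero ∙ ∑ (allFin n) (f ∘ suc)
  ∑-allFin-suc n f = ≈-reflexive (cong (λ fs → f zero ∙ foldr _∙_ ε fs)
    (trans (map-tabulate suc f) (sym (map-tabulate id (f ∘ suc)))))

  when-cong : ∀ {P : Set} (d : Dec P) {x y : A} → (P → x ≈ y) → when (does d) x ≈ when (does d) y
  when-cong (yes p) x≈y = x≈y p
  when-cong (no _)  x≈y = ≈-refl

  when-ε : ∀ t → when t ε ≈ ε
  when-ε true  = ≈-refl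
  when-ε false = ≈-refl

  when-distrib : ∀ t x y → when t (x ∙ y) ≈ when t x ∙ when t y
  when-distrib true  x y = ≈-refl
  when-distrib false x y = ≈-sym (identityˡ ε)

  when-∑ : ∀ {B : Set} t (xs : List B) f → when t (∑ xs f) ≈ ∑ xs (λ b → when t (f b))
  when-∑ true  xs f = ≈-refl
  when-∑ false xs f = ≈-sym (∑-ε xs)

  ∑-δˡ : ∀ {n} (v : Fin n) (f : Fin n → A) → ∑ (allFin n) (λ i → when (does (i ≟ v)) (f i)) ≈ f v
  ∑-δˡ {suc n} zero    f = ≈-trans (∑-allFin-suc n _) (≈-trans (∙-congˡ (∑-ε (allFin n))) (identityʳ _))
  ∑-δˡ {suc n} (suc v) f = ≈-trans (∑-allFin-suc n _) (≈-trans (identityˡ _) (∑-δˡ v (f ∘ suc)))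

  ∑-δʳ : ∀ {n} (v : Fin n) (f : Fin n → A) → ∑ (allFin n) (λ i → when (does (v ≟ i)) (f i)) ≈ f v
  ∑-δʳ {suc n} zero    f = ≈-trans (∑-allFin-suc n _) (≈-trans (∙-congˡ (∑-ε (allFin n))) (identityʳ _))
  ∑-δʳ {suc n} (suc v) f = ≈-trans (∑-allFin-suc n _) (≈-trans (identityˡ _) (∑-δʳ v (f ∘ suc)))

  sumE-cong : ∀ {n} {g h : Fin n → Fin n → A} → (∀ i j → i < j → g i j ≈ h i j) → sumE g ≈ sumE h
  sumE-cong {n} g≈h = ∑-cong (allFin n) λ i → ∑-cong (allFin n) λ j → when-cong (i <? j) (g≈h i j)

  sumE-distrib : ∀ {n} (g h : Fin n → Fin n → A) → sumE (λ i j → g i j ∙ h i j) ≈ sumE g ∙ sumE h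
  sumE-distrib {n} g h = ≈-trans
    (∑-cong (allFin n) λ i → ≈-trans
      (∑-cong (allFin n) λ j → when-distrib (does (i <? j)) (g i j) (h i j))
      (∑-distrib (allFin n) _ _))
    (∑-distrib (allFin n) _ _)

  sumE-∑ : ∀ {n} {B : Set} (xs : List B) (f : B → Fin n → Fin n → A) →
           sumE (λ i j → ∑ xs (λ b → f b i j)) ≈ ∑ xs (λ b → sumE (f b))
  sumE-∑ {n} xs f = ≈-trans
    (∑-cong (allFin n) λ i → ≈-trans
      (∑-cong (allFin n) λ j → when-∑ (does (i <? j)) xs _)
      (∑-swap (allFin n) xs _))
    (∑-swap (allFin n) xs _)

module ℕSum = FinSum ℕ.+-0-commutativeMonoid
module ℚSum = FinSum ℚ.+-0-commutativeMonoid
open ℕSum using (∑; when)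

∑-mono-≤ : ∀ {B : Set} (xs : List B) {f g : B → ℕ} → (∀ b → f b ℕ.≤ g b) → ∑ xs f ℕ.≤ ∑ xs g
∑-mono-≤ []       f≤g = ℕ.z≤n
∑-mono-≤ (x ∷ xs) f≤g = ℕ.+-mono-≤ (f≤g x) (∑-mono-≤ xs f≤g)

∑-const : ∀ n m → ∑ (allFin n) (λ _ → m) ≡ n * m
∑-const ℕ.zero  m = refl
∑-const (suc n) m = trans (ℕSum.∑-allFin-suc n _) (cong (m +_) (∑-const n m))

m*n≤o⇒n≤o/m : ∀ m n o .{{_ : ℕ.NonZero m}} → m * n ℕ.≤ o → n ℕ.≤ o / m
m*n≤o⇒n≤o/m m n o mn≤o =
  subst (ℕ._≤ o / m) (m*n/n≡m n m) (/-monoˡ-≤ m (subst (ℕ._≤ o) (ℕ.*-comm m n) mn≤o))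

bit : Bool → ℕ
bit b = if b then 1 else 0

module _ {n : ℕ} (F : EdgeSet n) where

  Adj-sym : ∀ {u w} → Adj F u w → Adj F w u
  Adj-sym (inj₁ e) = inj₂ e
  Adj-sym (inj₂ e) = inj₁ e

  neighbour : Fin n → Fin n → Bool
  neighbour v j = if does (j <? v) then F j v else if does (v <? j) then F v j else false

  neighbour⇒Adj : ∀ v j → neighbour v j ≡ true → Adj F v j
  neighbour⇒Adj v j = go (j <? v) (v <? j)
    where
    go : (j<v : Dec (j < v)) (v<j : Dec (v < j)) →
         (if does j<v then F j v else if does v<j then F v j else false) ≡ true → Adj F v j
    go (yes j<v) _         e = inj₂ (j<v , e)
    go (no _)    (yes v<j) e = inj₁ (v<j , e)
    go (no _)    (no _)    ()

  degree : Fin n → ℕ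
  degree v = ∑ (allFin n) (bit ∘ neighbour v)

  incident : Fin n → Fin n → Fin n → Bool
  incident v i j = does (i ≟ v) ∨ does (j ≟ v)

  incidentEdges : Fin n → ℕ
  incidentEdges v = sumEℕ (λ i j → when (incident v i j) (bit (F i j)))

  starWeight : Fin n → ℕ
  starWeight v = numEdges F + incidentEdges v

  -- Vertex zero is the new twin of v.
  duplicate : Fin n → EdgeSet (suc n)
  duplicate v zero    (suc j) = neighbour v j
  duplicate v (suc i) (suc j) = F i j
  duplicate v _       zero    = false

  collapse : Fin n → Fin (suc n) → Fin n
  collapse v zero    = v
  collapse v (suc i) = i

  collapse-Adj : ∀ v u w → Adj (duplicate v) u w → Adj F (collapse v u) (collapse v w)
  collapse-Adj v zero    (suc j) (inj₁ (_ , e))        = neighbour⇒Adj v j e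
  collapse-Adj v (suc i) zero    (inj₂ (_ , e))        = Adj-sym (neighbour⇒Adj v i e)
  collapse-Adj v (suc i) (suc j) (inj₁ (ℕ.s≤s i<j , e)) = inj₁ (i<j , e)
  collapse-Adj v (suc i) (suc j) (inj₂ (ℕ.s≤s j<i , e)) = inj₂ (j<i , e)
  collapse-Adj v zero    zero    (inj₁ (() , _))
  collapse-Adj v zero    zero    (inj₂ (() , _))
  collapse-Adj v zero    (suc j) (inj₂ (() , _))
  collapse-Adj v (suc i) zero    (inj₁ (() , _))

  duplicate-cliqueFree : ∀ {a} v → CliqueFree a F → CliqueFree a (duplicate v)
  duplicate-cliqueFree v cf (f , clique) =
    cf (collapse v ∘ f , λ p q p≢q → collapse-Adj v (f p) (f q) (clique p q p≢q))

  numEdges-duplicate : ∀ v → numEdges (duplicate v) ≡ degree v + numEdges F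
  numEdges-duplicate v = trans (ℕSum.∑-allFin-suc n row) (cong₂ _+_
    (ℕSum.∑-allFin-suc n (entry zero))
    (ℕSum.∑-cong (allFin n) λ i → ℕSum.∑-allFin-suc n (entry (suc i))))
    where
    entry : Fin (suc n) → Fin (suc n) → ℕ
    entry i j = when (does (i <? j)) (bit (duplicate v i j))
    row : Fin (suc n) → ℕ
    row i = ∑ (allFin (suc n)) (entry i)

  -- An edge at v lies either in row v of the upper triangle (v < j) or in its column (i < v).
  incidentEdges≡degree : ∀ v → incidentEdges v ≡ degree v
  incidentEdges≡degree v = begin
      incidentEdges v
    ≡⟨ ℕSum.∑-cong (allFin n) (λ i → ℕSum.∑-cong (allFin n) λ j → incident-split i j) ⟩
      ∑ (allFin n) (λ i → ∑ (allFin n) (λ j → fromRow i j + fromColumn i j))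
    ≡⟨ ℕSum.∑-cong (allFin n) (λ i → ℕSum.∑-distrib (allFin n) (fromRow i) (fromColumn i)) ⟩
      ∑ (allFin n) (λ i → ∑ (allFin n) (fromRow i) + ∑ (allFin n) (fromColumn i))
    ≡⟨ ℕSum.∑-distrib (allFin n) (λ i → ∑ (allFin n) (fromRow i)) (λ i → ∑ (allFin n) (fromColumn i)) ⟩
      ∑ (allFin n) (λ i → ∑ (allFin n) (fromRow i)) + ∑ (allFin n) (λ i → ∑ (allFin n) (fromColumn i))
    ≡⟨ cong₂ _+_
         (trans (ℕSum.∑-cong (allFin n) λ i → sym (ℕSum.when-∑ (does (i ≟ v)) (allFin n) after))
                (ℕSum.∑-δˡ v (λ _ → ∑ (allFin n) after)))
         (ℕSum.∑-cong (allFin n) λ i → ℕSum.∑-δˡ v (λ _ → before i)) ⟩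
      ∑ (allFin n) after + ∑ (allFin n) before
    ≡⟨ ℕ.+-comm (∑ (allFin n) after) (∑ (allFin n) before) ⟩
      ∑ (allFin n) before + ∑ (allFin n) after
    ≡⟨ sym (ℕSum.∑-distrib (allFin n) before after) ⟩
      ∑ (allFin n) (λ j → before j + after j)
    ≡⟨ sym (ℕSum.∑-cong (allFin n) λ j → bit-neighbour j (j <? v) (v <? j)) ⟩
      degree v
    ∎
    where
    open ≡-Reasoning
    before after : Fin n → ℕ
    before i = when (does (i <? v)) (bit (F i v))
    after  j = when (does (v <? j)) (bit (F v j))
    fromRow fromColumn : Fin n → Fin n → ℕ
    fromRow    i j = when (does (i ≟ v)) (after j)
    fromColumn i j = when (does (j ≟ v)) (before i)

    bit-neighbour : ∀ j (j<v : Dec (j < v)) (v<j : Dec (v < j)) →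
      bit (if does j<v then F j v else if does v<j then F v j else false)
      ≡ when (does j<v) (bit (F j v)) + when (does v<j) (bit (F v j))
    bit-neighbour j (yes j<v) (yes v<j) = ⊥-elim (<-asym j<v v<j)
    bit-neighbour j (yes _)   (no _)    = sym (ℕ.+-identityʳ _)
    bit-neighbour j (no _)    (yes _)   = refl
    bit-neighbour j (no _)    (no _)    = refl

    when-v<v : ∀ (v<v : Dec (v < v)) x → when (does v<v) x ≡ when (does v<v) x + when (does v<v) x
    when-v<v (yes v<v) x = ⊥-elim (<-irrefl refl v<v)
    when-v<v (no _)    x = refl

    incident-split : ∀ i j → when (does (i <? j)) (when (incident v i j) (bit (F i j))) ≡ fromRow i j + fromColumn i j
    incident-split i j with i ≟ v | j ≟ v
    ... | yes refl | yes refl = when-v<v (v <? v) _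
    ... | yes refl | no _     = sym (ℕ.+-identityʳ _)
    ... | no _     | yes refl = refl
    ... | no _     | no _     = ℕSum.when-ε (does (i <? j))

  -- Handshake lemma: each edge {i,j} is counted once at v = i and once at v = j.
  ∑-incidentEdges : ∑ (allFin n) incidentEdges ≡ numEdges F + numEdges F
  ∑-incidentEdges = begin
      ∑ (allFin n) incidentEdges
    ≡⟨ sym (ℕSum.sumE-∑ (allFin n) λ v i j → when (incident v i j) (bit (F i j))) ⟩
      sumEℕ (λ i j → ∑ (allFin n) (λ v → when (incident v i j) (bit (F i j))))
    ≡⟨ ℕSum.sumE-cong (λ i j i<j → incidence-count i<j (bit (F i j))) ⟩
      sumEℕ (λ i j → bit (F i j) + bit (F i j))
    ≡⟨ ℕSum.sumE-distrib (λ i j → bit (F i j)) (λ i j → bit (F i j)) ⟩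
      numEdges F + numEdges F
    ∎
    where
    open ≡-Reasoning
    incident-split : ∀ {i j} → i < j → ∀ v b → when (incident v i j) b ≡ when (does (i ≟ v)) b + when (does (j ≟ v)) b
    incident-split {i} {j} i<j v b with i ≟ v | j ≟ v
    ... | yes refl | yes refl = ⊥-elim (<-irrefl refl i<j)
    ... | yes _    | no _     = sym (ℕ.+-identityʳ b)
    ... | no _     | _        = refl

    incidence-count : ∀ {i j} → i < j → ∀ b → ∑ (allFin n) (λ v → when (incident v i j) b) ≡ b + b
    incidence-count {i} {j} i<j b = trans (ℕSum.∑-cong (allFin n) λ v → incident-split i<j v b)
      (trans (ℕSum.∑-distrib (allFin n) _ _) (cong₂ _+_ (ℕSum.∑-δʳ i _) (ℕSum.∑-δʳ j _)))

  module _ {a k : ℕ} (ex : IsEx (suc n) a k) (cf : CliqueFree a F) where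

    starWeight≤ex : ∀ v → starWeight v ℕ.≤ k
    starWeight≤ex v = subst (ℕ._≤ k) numEdges≡starWeight (proj₂ ex (duplicate v) (duplicate-cliqueFree v cf))
      where
      numEdges≡starWeight : numEdges (duplicate v) ≡ starWeight v
      numEdges≡starWeight = trans (numEdges-duplicate v)
        (trans (ℕ.+-comm (degree v) (numEdges F)) (cong (numEdges F +_) (sym (incidentEdges≡degree v))))

    numEdges≤ex : suc (suc n) * numEdges F ℕ.≤ n * k
    numEdges≤ex = subst₂ ℕ._≤_ ∑-starWeight (∑-const n k) (∑-mono-≤ (allFin n) starWeight≤ex)
      where
      m : ℕ
      m = numEdges F
      ∑-starWeight : ∑ (allFin n) starWeight ≡ suc (suc n) * m
      ∑-starWeight = begin
          ∑ (allFin n) starWeight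
        ≡⟨ ℕSum.∑-distrib (allFin n) (λ _ → m) incidentEdges ⟩
          ∑ (allFin n) (λ _ → m) + ∑ (allFin n) incidentEdges
        ≡⟨ cong₂ _+_ (∑-const n m) ∑-incidentEdges ⟩
          n * m + (m + m)
        ≡⟨ trans (ℕ.+-comm (n * m) (m + m)) (ℕ.+-assoc m m (n * m)) ⟩
          suc (suc n) * m
        ∎
        where open ≡-Reasoning

ℕtoℚ-mkℚ : ∀ k → ℕtoℚ k ≡ ℚ.mkℚ (ℤ.+ k) 0 (coprime-sym (1-coprimeTo k))
ℕtoℚ-mkℚ k = ℚ.normalize-coprime (coprime-sym (1-coprimeTo k))

ℕtoℚ-+ : ∀ m n → ℕtoℚ (m + n) ≡ ℕtoℚ m ℚ.+ ℕtoℚ n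
ℕtoℚ-+ m n = sym (trans (cong₂ ℚ._+_ (ℕtoℚ-mkℚ m) (ℕtoℚ-mkℚ n))
  (cong (ℚ._/ 1) (cong₂ ℤ._+_ (ℤ.*-identityʳ (ℤ.+ m)) (ℤ.*-identityʳ (ℤ.+ n)))))

ℕtoℚ-mono-≤ : ∀ {m n} → m ℕ.≤ n → ℕtoℚ m ℚ.≤ ℕtoℚ n
ℕtoℚ-mono-≤ {m} {n} m≤n = subst₂ ℚ._≤_ (sym (ℕtoℚ-mkℚ m)) (sym (ℕtoℚ-mkℚ n))
  (ℚ.*≤* (subst₂ ℤ._≤_ (sym (ℤ.*-identityʳ (ℤ.+ m))) (sym (ℤ.*-identityʳ (ℤ.+ n))) (ℤ.+≤+ m≤n)))

ℕtoℚ-∑ : ∀ {B : Set} (xs : List B) (f : B → ℕ) → ℕtoℚ (∑ xs f) ≡ ℚSum.∑ xs (ℕtoℚ ∘ f)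
ℕtoℚ-∑ []       f = refl
ℕtoℚ-∑ (x ∷ xs) f = trans (ℕtoℚ-+ (f x) (∑ xs f)) (cong (ℕtoℚ (f x) ℚ.+_) (ℕtoℚ-∑ xs f))

ℕtoℚ-when : ∀ t m → ℕtoℚ (when t m) ≡ ℚSum.when t (ℕtoℚ m)
ℕtoℚ-when true  m = refl
ℕtoℚ-when false m = refl

ℕtoℚ-sumE : ∀ {n} (g : Fin n → Fin n → ℕ) → ℕtoℚ (sumEℕ g) ≡ sumEℚ (λ i j → ℕtoℚ (g i j))
ℕtoℚ-sumE {n} g = trans (ℕtoℚ-∑ (allFin n) _) (ℚSum.∑-cong (allFin n) λ i →
  trans (ℕtoℚ-∑ (allFin n) _) (ℚSum.∑-cong (allFin n) λ j → ℕtoℚ-when (does (i <? j)) (g i j)))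

∑-*ˡ : ∀ {B : Set} (xs : List B) (c : ℚ) (f : B → ℚ) → ℚSum.∑ xs (λ b → c ℚ.* f b) ≡ c ℚ.* ℚSum.∑ xs f
∑-*ˡ []       c f = sym (ℚ.*-zeroʳ c)
∑-*ˡ (x ∷ xs) c f = trans (cong (c ℚ.* f x ℚ.+_) (∑-*ˡ xs c f)) (sym (ℚ.*-distribˡ-+ c (f x) _))

sumE-*ˡ : ∀ {n} (c : ℚ) (g : Fin n → Fin n → ℚ) → sumEℚ (λ i j → c ℚ.* g i j) ≡ c ℚ.* sumEℚ g
sumE-*ˡ {n} c g = trans
  (ℚSum.∑-cong (allFin n) λ i → trans
    (ℚSum.∑-cong (allFin n) λ j → when-* (does (i <? j)) (g i j))
    (∑-*ˡ (allFin n) c _))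
  (∑-*ˡ (allFin n) c _)
  where
  when-* : ∀ t y → ℚSum.when t (c ℚ.* y) ≡ c ℚ.* ℚSum.when t y
  when-* true  y = refl
  when-* false y = sym (ℚ.*-zeroʳ c)

sumE-*-χ≡starWeight : ∀ {n} (F : EdgeSet n) v → sumEℚ (λ i j → starCoeff v i j ℚ.* χ F i j) ≡ ℕtoℚ (starWeight F v)
sumE-*-χ≡starWeight F v = begin
    sumEℚ (λ i j → starCoeff v i j ℚ.* χ F i j)
  ≡⟨ ℚSum.sumE-cong (λ i j _ → starCoeff-χ (incident F v i j) (F i j)) ⟩
    sumEℚ (λ i j → ℕtoℚ (edge i j) ℚ.+ ℕtoℚ (atV i j))
  ≡⟨ ℚSum.sumE-distrib (λ i j → ℕtoℚ (edge i j)) (λ i j → ℕtoℚ (atV i j)) ⟩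
    sumEℚ (λ i j → ℕtoℚ (edge i j)) ℚ.+ sumEℚ (λ i j → ℕtoℚ (atV i j))
  ≡⟨ sym (cong₂ ℚ._+_ (ℕtoℚ-sumE edge) (ℕtoℚ-sumE atV)) ⟩
    ℕtoℚ (numEdges F) ℚ.+ ℕtoℚ (incidentEdges F v)
  ≡⟨ sym (ℕtoℚ-+ (numEdges F) (incidentEdges F v)) ⟩
    ℕtoℚ (starWeight F v)
  ∎
  where
  open ≡-Reasoning
  edge atV : Fin _ → Fin _ → ℕ
  edge i j = bit (F i j)
  atV  i j = when (incident F v i j) (bit (F i j))
  starCoeff-χ : ∀ t b → (if t then ℚ.1ℚ ℚ.+ ℚ.1ℚ else ℚ.1ℚ) ℚ.* (if b then ℚ.1ℚ else ℚ.0ℚ)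
                        ≡ ℕtoℚ (bit b) ℚ.+ ℕtoℚ (when t (bit b))
  starCoeff-χ true  true  = refl
  starCoeff-χ true  false = refl
  starCoeff-χ false true  = refl
  starCoeff-χ false false = refl

sumE-1* : ∀ {n} (y : EdgeVec n) → sumEℚ (λ i j → ℚ.1ℚ ℚ.* y i j) ≡ sumEℚ y
sumE-1* y = ℚSum.sumE-cong (λ i j _ → ℚ.*-identityˡ (y i j))

sumE-χ≡numEdges : ∀ {n} (F : EdgeSet n) → sumEℚ (χ F) ≡ ℕtoℚ (numEdges F)
sumE-χ≡numEdges F = sym (trans (ℕtoℚ-sumE (λ i j → bit (F i j))) (ℚSum.sumE-cong λ i j _ → χ≡bit (F i j)))
  where
  χ≡bit : ∀ b → ℕtoℚ (bit b) ≡ (if b then ℚ.1ℚ else ℚ.0ℚ)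
  χ≡bit true  = refl
  χ≡bit false = refl

valid-on-T : ∀ {n a} (c : Fin n → Fin n → ℚ) (K : ℚ) →
  (∀ F → CliqueFree a F → sumEℚ (λ i j → c i j ℚ.* χ F i j) ℚ.≤ K) →
  ∀ x → InT n a x → sumEℚ (λ i j → c i j ℚ.* x i j) ℚ.≤ K
valid-on-T {n} {a} c K valid-at-χ x (L , weights , ∑weights≡1 , x≡∑) = begin
    sumEℚ (λ i j → c i j ℚ.* x i j)
  ≡⟨ ℚSum.sumE-cong (λ i j i<j → trans (cong (c i j ℚ.*_) (x≡∑ i j i<j)) (sym (∑-*ˡ L (c i j) _))) ⟩
    sumEℚ (λ i j → ℚSum.∑ L (λ p → c i j ℚ.* (proj₁ p ℚ.* χ (proj₂ p) i j)))
  ≡⟨ ℚSum.sumE-∑ L (λ p i j → c i j ℚ.* (proj₁ p ℚ.* χ (proj₂ p) i j)) ⟩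
    ℚSum.∑ L (λ p → sumEℚ (λ i j → c i j ℚ.* (proj₁ p ℚ.* χ (proj₂ p) i j)))
  ≡⟨ ℚSum.∑-cong L (λ p → trans (ℚSum.sumE-cong λ i j _ → swap-scalar (c i j) (proj₁ p) (χ (proj₂ p) i j))
                                 (sumE-*ˡ (proj₁ p) (λ i j → c i j ℚ.* χ (proj₂ p) i j))) ⟩
    ℚSum.∑ L (λ p → proj₁ p ℚ.* cχ (proj₂ p))
  ≤⟨ weighted-bound L weights ⟩
    ℚSum.∑ L (λ p → proj₁ p ℚ.* K)
  ≡⟨ trans (ℚSum.∑-cong L λ p → ℚ.*-comm (proj₁ p) K) (∑-*ˡ L K proj₁) ⟩
    K ℚ.* ℚSum.∑ L proj₁
  ≡⟨ trans (cong (K ℚ.*_) ∑weights≡1) (ℚ.*-identityʳ K) ⟩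
    K
  ∎
  where
  open ℚ.≤-Reasoning
  cχ : EdgeSet n → ℚ
  cχ F = sumEℚ (λ i j → c i j ℚ.* χ F i j)

  swap-scalar : ∀ p q r → p ℚ.* (q ℚ.* r) ≡ q ℚ.* (p ℚ.* r)
  swap-scalar p q r = trans (sym (ℚ.*-assoc p q r)) (trans (cong (ℚ._* r) (ℚ.*-comm p q)) (ℚ.*-assoc q p r))

  weighted-bound : ∀ L → All (λ { (λ′ , F) → (ℚ.0ℚ ℚ.≤ λ′) × CliqueFree a F }) L →
                   ℚSum.∑ L (λ p → proj₁ p ℚ.* cχ (proj₂ p)) ℚ.≤ ℚSum.∑ L (λ p → proj₁ p ℚ.* K)
  weighted-bound []      []                = ℚ.≤-refl
  weighted-bound (p ∷ L) ((0≤λ , cf) ∷ ws) = ℚ.+-mono-≤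
    (ℚ.*-monoˡ-≤-nonNeg (proj₁ p) {{ℚ.nonNegative 0≤λ}} (valid-at-χ (proj₂ p) cf)) (weighted-bound L ws)

mainTheorem3 : (a n : ℕ) → a ≥ 2 → n ≥ 1 → (k : ℕ) → IsEx (suc n) a k →
    ((v : Fin n) (x : EdgeVec n) → InT n a x →
      sumEℚ (λ i j → starCoeff v i j ℚ.* x i j) ℚ.≤ ℕtoℚ k)
    × ((x : EdgeVec n) → InT n a x →
      sumEℚ x ℚ.≤ ℕtoℚ ((n * k) / suc (suc n)))
mainTheorem3 a n _ _ k ex = starInequality , edgeInequality
  where
  starInequality : (v : Fin n) (x : EdgeVec n) → InT n a x →
    sumEℚ (λ i j → starCoeff v i j ℚ.* x i j) ℚ.≤ ℕtoℚ k
  starInequality v = valid-on-T (starCoeff v) (ℕtoℚ k) λ F cf →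
    subst (ℚ._≤ ℕtoℚ k) (sym (sumE-*-χ≡starWeight F v)) (ℕtoℚ-mono-≤ (starWeight≤ex F ex cf v))

  bound : ℚ
  bound = ℕtoℚ ((n * k) / suc (suc n))
  edgeInequality : (x : EdgeVec n) → InT n a x → sumEℚ x ℚ.≤ bound
  edgeInequality x x∈T = subst (ℚ._≤ bound) (sumE-1* x) (valid-on-T (λ _ _ → ℚ.1ℚ) bound at-χ x x∈T)
    where
    at-χ : ∀ F → CliqueFree a F → sumEℚ (λ i j → ℚ.1ℚ ℚ.* χ F i j) ℚ.≤ bound
    at-χ F cf = subst (ℚ._≤ bound) (sym (trans (sumE-1* (χ F)) (sumE-χ≡numEdges F)))
      (ℕtoℚ-mono-≤ (m*n≤o⇒n≤o/m (suc (suc n)) (numEdges F) (n * k) (numEdges≤ex F ex cf)))
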